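{- Let $X$ be a countably infinite set. Then $\mathbf{AF}^X_{str}$ is not separable, and therefore not a Polish space.
   Context: A quiver on $X$ is a function $Q:X\times X\to\mathbb{Z}$ with $Q(x,y)=-Q(y,x)$; $\mathbf{AF}^X$ is the set of all of them. For $V\subseteq X$, $\lambda_V(Q)(a,b)=Q(a,b)$ if $a\in V$ or $b\in V$, else $0$. $\mathbf{AF}^X_{str}$ is $\mathbf{AF}^X$ with the topology generated by the basic sets $W_{Q,V}=\{Q':\lambda_V(Q')=\lambda_V(Q)\}$ for $Q\in\mathbf{AF}^X$ and finite $V\subseteq X$. -}

module Defs where

open import Data.Integer using (ℤ; -_)
open import Data.Nat using (ℕ)
open import Data.List using (List)
open import Data.List.Membership.Propositional using (_∈_)
open import Data.Product using (Σ; Σ-syntax; ∃; ∃-syntax; _×_; proj₁)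
open import Data.Sum using (_⊎_)
open import Relation.Binary.PropositionalEquality using (_≡_)

-- A quiver on X: antisymmetric ℤ-valued function on X × X.
AF : Set → Set
AF X = Σ (X → X → ℤ) (λ Q → ∀ x y → Q x y ≡ - Q y x)

-- Rather than an explicit λ_V (which would need decidable membership),
-- the basic set W_{Q,V} = {Q' | λ_V(Q') = λ_V(Q)} is written out
-- pointwise: Q' and Q agree at (a,b) whenever a ∈ V or b ∈ V
-- (outside that region both λ_V's are 0, so they agree automatically).
W : {X : Set} → AF X → List X → AF X → Set
W Q V Q' = ∀ a b → (a ∈ V ⊎ b ∈ V) → proj₁ Q' a b ≡ proj₁ Q a b

-- Open sets of AF^X_str: the topology generated by the basic sets
-- W_{Q,V}. These sets form a base (W_{P,V∪V'} ⊆ W_{Q,V} ∩ W_{Q',V'}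
-- for P in the intersection), so U is open iff every point of U has a
-- basic neighbourhood contained in U.
IsOpen : {X : Set} → (AF X → Set) → Set
IsOpen {X} U = ∀ Q → U Q → Σ[ V ∈ List X ] (∀ Q' → W Q V Q' → U Q')

Dense : {X : Set} → (ℕ → AF X) → Set₁
Dense {X} D = ∀ (U : AF X → Set) → IsOpen U → (∃[ Q ] U Q) → ∃[ n ] U (D n)

-- Separable: has a countable dense subset. (AF^X is nonempty, so the
-- empty set is never dense; a nonempty countable subset is the range of
-- some ℕ-sequence.)
Separable : Set → Set₁
Separable X = ∃[ D ] Dense {X} D

{-# OPTIONS --safe #-}
-- A diagonal argument. For a vertex a, vertices x n and integers r n, the
-- quivers Q with Q(a, x n) ≠ r n for every n form an open set: membership
-- only depends on arrows at a, so V = {a} witnesses openness. Taking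
-- r n = D n (a, x n) gives an open set avoiding every D n, and it is
-- nonempty because on a countable X the row at a can be prescribed freely
-- along an enumeration of the remaining vertices.
module Submission where

open import Defs
open import Data.Nat using (ℕ; zero; suc)
open import Data.Integer using (ℤ; -_; 0ℤ) renaming (suc to sucℤ)
open import Data.Integer.Properties using (neg-involutive; i≢suc[i])
open import Data.List using (_∷_; [])
open import Data.List.Relation.Unary.Any using (here)
open import Data.Product using (_,_; proj₁; proj₂; Σ-syntax)
open import Data.Sum using (inj₁)
open import Function using (_∘_)
open import Function.Bundles using (_↔_; Inverse)
open import Relation.Nullary using (¬_)
open import Relation.Binary.PropositionalEquality using (_≡_; _≢_; refl; sym; trans; cong₂)

AvoidsRow : {X : Set} → X → (ℕ → X) → (ℕ → ℤ) → AF X → Set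
AvoidsRow a x r Q = ∀ n → proj₁ Q a (x n) ≢ r n

avoidsRow-isOpen : {X : Set} (a : X) (x : ℕ → X) (r : ℕ → ℤ) → IsOpen (AvoidsRow a x r)
avoidsRow-isOpen a x r Q Q-avoids = a ∷ [] , λ Q′ Q′∈W n Q′≡r →
  Q-avoids n (trans (sym (Q′∈W a (x n) (inj₁ (here refl)))) Q′≡r)

RowPrescribable : {X : Set} → X → (ℕ → X) → Set
RowPrescribable {X} a x = ∀ (g : ℕ → ℤ) → Σ[ Q ∈ AF X ] ∀ n → proj₁ Q a (x n) ≡ g n

avoidsRow-nonempty : {X : Set} {a : X} {x : ℕ → X} → RowPrescribable a x →
  ∀ r → Σ[ Q ∈ AF X ] AvoidsRow a x r Q
avoidsRow-nonempty prescribe r with Q , Qaxn≡1+r ← prescribe (sucℤ ∘ r) =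
  Q , λ n Qaxn≡r → i≢suc[i] (trans (sym Qaxn≡r) (Qaxn≡1+r n))

¬separable-if-rowPrescribable : {X : Set} (a : X) (x : ℕ → X) →
  RowPrescribable a x → ¬ Separable X
¬separable-if-rowPrescribable a x prescribe (D , dense) =
  let n , Dn-avoids = dense (AvoidsRow a x r) (avoidsRow-isOpen a x r)
                            (avoidsRow-nonempty prescribe r)
  in Dn-avoids n refl
  where
  r : ℕ → ℤ
  r n = proj₁ (D n) a (x n)

star : (ℕ → ℤ) → AF ℕ
star g = Q , antisym
  where
  Q : ℕ → ℕ → ℤ
  Q zero    (suc m) = g m
  Q (suc m) zero    = - g m
  Q _       _       = 0ℤ
  antisym : ∀ i j → Q i j ≡ - Q j i
  antisym zero    zero    = refl
  antisym zero    (suc m) = sym (neg-involutive (g m))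
  antisym (suc m) zero    = refl
  antisym (suc _) (suc _) = refl

pullback : {X Y : Set} → (X → Y) → AF Y → AF X
pullback h (Q , antisym) = (λ a b → Q (h a) (h b)) , λ a b → antisym (h a) (h b)

proposition3p14 : {X : Set} → X ↔ ℕ → ¬ Separable X
proposition3p14 e = ¬separable-if-rowPrescribable (from 0) (from ∘ suc)
  λ g → pullback to (star g) ,
        λ n → cong₂ (proj₁ (star g)) (strictlyInverseˡ 0) (strictlyInverseˡ (suc n))
  where open Inverse e
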